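{- Let $X$ be a word in $\{\mathrm D,\mathrm E,\mathrm A\}^*$ and let $T$ be a condensed multi-Catalan tableau of type $\mathrm E X$. Then the boundary transition of $T$ corresponding to the PASEP transition $\mathrm EX\to\mathrm DX$ (defined below) results in a valid condensed multi-Catalan tableau of type $\mathrm D X$.
   Context: Condensed multi-Catalan tableaux. Let $W\in\{\mathrm D,\mathrm E,\mathrm A\}^n$ have $k$ letters $\mathrm D$ and $r$ letters $\mathrm A$. Starting at the north-east corner of a rectangle with $k+r$ rows and $n-k$ columns, draw the lattice path $L(W)$ by reading $W$ left to right: $\mathrm D$ gives a south step, $\mathrm E$ a west step, $\mathrm A$ a west step followed by a south step. Let $Y(W)$ be the Young diagram (rows left-justified and top-justified in the rectangle) whose south-east boundary is $L(W)$: its $i$-th row (from the top) has length equal to the number of west steps of $L(W)$ after its $i$-th south step. Each row corresponds to a south step and each column to a west step. A row is a D-row or A-row according as its south step comes from a $\mathrm D$ or an $\mathrm A$; a column is an E-column or A-column according as its west step comes from an $\mathrm E$ or an $\mathrm A$. A DE box is a box in a D-row and E-column, and similarly DA, AE, AA boxes. A condensed multi-Catalan tableau of type $W$ is a filling of the boxes of $Y(W)$, each box being empty or containing $\alpha$ or $\beta$, such that: every box having a $\beta$ somewhere to its right in its row, or an $\alpha$ somewhere below it in its column, is empty; every other box contains $\alpha$ or $\beta$ if it is a DE box, contains $\beta$ if it is a DA box, contains $\alpha$ if it is an AE box, and is empty if it is an AA box. Boundary transition $\mathrm EX\to\mathrm DX$: if the type begins with $\mathrm E$, $T$ has at least one empty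 (length-$0$) column at its east end. Remove the rightmost such empty column; then insert a new row whose length is the maximal possible length keeping the semi-perimeter fixed, namely the number $m$ of columns remaining, with a $\beta$ in its rightmost box and all other boxes empty, placed directly below every existing row of length $m$ (the lowest position possible for that length). If $m=0$, insert a row of length $0$ containing no $\beta$. All other rows and columns keep their contents. Finally label the boundary path by the word $\mathrm DX$. -}

module Defs where

open import Data.Nat using (ℕ; zero; suc; _<_; _<ᵇ_; _≡ᵇ_)
open import Data.List using (List; []; _∷_)
open import Data.Maybe using (Maybe; just; nothing)
open import Data.Bool using (if_then_else_)
open import Data.Product using (Σ; ∃; _×_; _,_)
open import Data.Sum using (_⊎_)
open import Relation.Binary.PropositionalEquality using (_≡_)
open import Relation.Nullary using (¬_)

data Letter : Set where
  D E A : Letter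

data Cell : Set where
  empty α β : Cell

at : List Letter → ℕ → Maybe Letter
at []       _       = nothing
at (x ∷ _)  zero    = just x
at (_ ∷ xs) (suc p) = at xs p

IsRow : List Letter → ℕ → Set
IsRow W p = at W p ≡ just D ⊎ at W p ≡ just A

IsCol : List Letter → ℕ → Set
IsCol W q = at W q ≡ just E ⊎ at W q ≡ just A

-- Rows and columns of Y(W) are indexed by the positions in W of the letters
-- producing their south / west steps.  Row p contains column q iff the west
-- step of q comes after the south step of p on L(W), i.e. iff p < q
-- (for an A the west step precedes its own south step).
-- Column q' lies to the right of column q iff q' < q; row p' lies below
-- row p iff p < p'.
Box : List Letter → ℕ → ℕ → Set
Box W p q = IsRow W p × IsCol W q × p < q

-- A filling assigns a content to every (row, column) pair; only the values
-- on boxes of Y(W) are relevant.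
Filling : Set
Filling = ℕ → ℕ → Cell

Forced : List Letter → Filling → ℕ → ℕ → Set
Forced W T p q =
  (∃ λ q' → IsCol W q' × p < q' × q' < q × T p q' ≡ β)
  ⊎ (∃ λ p' → IsRow W p' × p < p' × p' < q × T p' q ≡ α)

Allowed : Maybe Letter → Maybe Letter → Cell → Set
Allowed (just D) (just E) c = c ≡ α ⊎ c ≡ β
Allowed (just D) (just A) c = c ≡ β
Allowed (just A) (just E) c = c ≡ α
Allowed (just A) (just A) c = c ≡ empty
Allowed _        _        c = c ≡ empty       -- never used on boxes

Valid : List Letter → Filling → Set
Valid W T = ∀ p q → Box W p q →
  (Forced W T p q → T p q ≡ empty) ×
  (¬ Forced W T p q → Allowed (at W p) (at W q) (T p q))

leadingD : List Letter → ℕ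
leadingD (D ∷ xs) = suc (leadingD xs)
leadingD _        = 0

-- In type EX, position 0 is the rightmost column and it is empty; it is the
-- rightmost empty column and is removed.  With k = leadingD X, the rows of
-- length m (= number of remaining columns) are the rows at positions 1..k.
-- In type DX these move to positions 0..k-1 and the new row sits at
-- position k (directly below them).  Its rightmost box is in column k+1
-- (the first E/A of X); it gets β there and is empty elsewhere.  If m = 0
-- (X has no E or A), position k+1 is not a column and the new row has no box.
-- All other rows and columns (kept at their positions) keep their contents.
transition : List Letter → Filling → Filling
transition X T p q =
  if p <ᵇ k then T (suc p) q
  else if p ≡ᵇ k then (if q ≡ᵇ suc k then β else empty)
  else T p q
  where k = leadingD X

-- Away from the new row k = leadingD X, the transition only relabels rows: old rows 1..k move up
-- to 0..k−1 and lower rows stay put.  This relabelling is an order isomorphism between the old rows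
-- and the new rows other than k, it preserves letters and contents, and every column lies beyond
-- position k; since the new row contains no α, whether a box is forced is therefore unchanged.  In
-- the new row, the β sits in the rightmost column, so it is unforced (and allowed, the row being a
-- D-row), and it forces all other boxes of the row, which are indeed empty.
module Submission where

open import Defs
open import Data.Bool using (true; false; if_then_else_)
open import Data.Empty using (⊥-elim)
open import Data.List using (List; []; _∷_)
open import Data.Maybe using (Maybe; just)
open import Data.Nat using (ℕ; zero; suc; _<_; _≤_; z≤n; s≤s; _<ᵇ_; _≡ᵇ_)
open import Data.Nat.Properties
  using (_≟_; <-cmp; <ᵇ-reflects-<; ≡ᵇ⇒≡; ≡⇒≡ᵇ; ≤-refl; ≤-<-trans; <-≤-trans; <-trans; n<1+n; n≤1+n;
         n≮n; <-asym; <⇒≢; ≤-pred; m≤n⇒m≤1+n; m≤n⇒m<n∨m≡n)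
open import Data.Product using (∃; _×_; _,_; proj₁; proj₂)
open import Data.Sum using (_⊎_; inj₁; inj₂)
open import Data.Sum.Function.Propositional using (_⊎-⇔_)
open import Function.Bundles using (_⇔_; mk⇔; Equivalence)
open import Relation.Binary using (tri<; tri≈; tri>)
open import Relation.Binary.PropositionalEquality using (_≡_; _≢_; refl; sym; trans; subst)
open import Relation.Nullary using (¬_; yes; no)
open import Relation.Nullary.Reflects using (Reflects; ofʸ; ofⁿ; fromEquivalence)

ValidAt : List Letter → Filling → ℕ → ℕ → Set
ValidAt W T p q =
  (Forced W T p q → T p q ≡ empty) × (¬ Forced W T p q → Allowed (at W p) (at W q) (T p q))

validAt-transport : ∀ {W W′ T T′ p p′ q q′} →
  Forced W′ T′ p′ q′ ⇔ Forced W T p q → T′ p′ q′ ≡ T p q →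
  at W′ p′ ≡ at W p → at W′ q′ ≡ at W q →
  ValidAt W T p q → ValidAt W′ T′ p′ q′
validAt-transport F⇔ eqT eqRow eqCol (forced , unforced)
  rewrite eqT | eqRow | eqCol =
  (λ f → forced (Equivalence.to F⇔ f)) , (λ ¬f → unforced (λ f → ¬f (Equivalence.from F⇔ f)))

BetaRight : List Letter → Filling → ℕ → ℕ → Set
BetaRight W T p q = ∃ λ q′ → IsCol W q′ × p < q′ × q′ < q × T p q′ ≡ β

AlphaBelow : List Letter → Filling → ℕ → ℕ → Set
AlphaBelow W T p q = ∃ λ p′ → IsRow W p′ × p < p′ × p′ < q × T p′ q ≡ α

IsRowLetter : Maybe Letter → Set
IsRowLetter l = l ≡ just D ⊎ l ≡ just A

β-allowed-in-D-row : ∀ {l} → l ≡ just E ⊎ l ≡ just A → Allowed (just D) l β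
β-allowed-in-D-row (inj₁ refl) = inj₂ refl
β-allowed-in-D-row (inj₂ refl) = refl

-- OldRow k p p₀: row p of the new tableau (p ≢ k) carries the contents of row p₀ of the old one.
data OldRow (k : ℕ) : ℕ → ℕ → Set where
  shifted : ∀ {p} → p < k → OldRow k p (suc p)
  kept    : ∀ {p} → k < p → OldRow k p p

oldRow-or-new : ∀ k p → p ≡ k ⊎ ∃ (OldRow k p)
oldRow-or-new k p with <-cmp p k
... | tri< p<k _ _ = inj₂ (suc p , shifted p<k)
... | tri≈ _ p≡k _ = inj₁ p≡k
... | tri> _ _ k<p = inj₂ (p , kept k<p)

oldRow-onto : ∀ k j → ∃ λ p → OldRow k p (suc j)
oldRow-onto k j with <-cmp j k
... | tri< j<k _ _ = j , shifted j<k
... | tri≈ _ refl _ = suc j , kept (n<1+n j)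
... | tri> _ _ k<j = suc j , kept (<-trans k<j (n<1+n j))

oldRow-≤ : ∀ {k p p₀} → OldRow k p p₀ → p ≤ p₀
oldRow-≤ (shifted _) = n≤1+n _
oldRow-≤ (kept _)    = ≤-refl

oldRow-< : ∀ {k p p₀ q} → OldRow k p p₀ → k < q → p < q → p₀ < q
oldRow-< (shifted p<k) k<q _ = <-≤-trans (s≤s p<k) k<q
oldRow-< (kept _)      _  p<q = p<q

oldRow-mono : ∀ {k p p′ p₀ p₀′} → OldRow k p p₀ → OldRow k p′ p₀′ → p < p′ → p₀ < p₀′
oldRow-mono (shifted _)   (shifted _)   p<p′ = s≤s p<p′
oldRow-mono (shifted p<k) (kept k<p′)   _    = <-≤-trans (s≤s p<k) k<p′
oldRow-mono (kept k<p)    (shifted p′<k) p<p′ = ⊥-elim (<-asym (<-trans k<p p<p′) p′<k)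
oldRow-mono (kept _)      (kept _)      p<p′ = p<p′

oldRow-reflects : ∀ {k p p′ p₀ p₀′} → OldRow k p p₀ → OldRow k p′ p₀′ → p₀ < p₀′ → p < p′
oldRow-reflects (shifted _)   (shifted _)    p₀<p₀′ = ≤-pred p₀<p₀′
oldRow-reflects (shifted p<k) (kept k<p′)    _      = <-trans p<k k<p′
oldRow-reflects (kept k<p)    (shifted p′<k) p<1+p′ =
  ⊥-elim (n≮n _ (≤-<-trans (≤-pred p<1+p′) (<-trans p′<k k<p)))
oldRow-reflects (kept _)      (kept _)       p<p′   = p<p′

leadingD-prefix : ∀ X {p} → p < leadingD X → at X p ≡ just D
leadingD-prefix (D ∷ X) {zero}  _         = refl
leadingD-prefix (D ∷ X) {suc p} (s≤s p<k) = leadingD-prefix X p<k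

leadingD≤column : ∀ X {j} → IsCol X j → leadingD X ≤ j
leadingD≤column []      (inj₁ ())
leadingD≤column []      (inj₂ ())
leadingD≤column (D ∷ X) {zero} (inj₁ ())
leadingD≤column (D ∷ X) {zero} (inj₂ ())
leadingD≤column (D ∷ X) {suc j} c = s≤s (leadingD≤column X c)
leadingD≤column (E ∷ X) _ = z≤n
leadingD≤column (A ∷ X) _ = z≤n

column-at-leadingD : ∀ X {j} → IsCol X j → IsCol X (leadingD X)
column-at-leadingD []      (inj₁ ())
column-at-leadingD []      (inj₂ ())
column-at-leadingD (D ∷ X) {zero} (inj₁ ())
column-at-leadingD (D ∷ X) {zero} (inj₂ ())
column-at-leadingD (D ∷ X) {suc j} c = column-at-leadingD X c
column-at-leadingD (E ∷ X) _ = inj₁ refl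
column-at-leadingD (A ∷ X) _ = inj₂ refl

≡ᵇ-reflects-≡ : ∀ m n → Reflects (m ≡ n) (m ≡ᵇ n)
≡ᵇ-reflects-≡ m n = fromEquivalence (≡ᵇ⇒≡ m n) (≡⇒≡ᵇ m n)

module _ (X : List Letter) (T : Filling) where
  private
    k  = leadingD X
    T′ = transition X T

  oldRow-letter : ∀ {p p₀} → OldRow k p p₀ → at (D ∷ X) p ≡ at (E ∷ X) p₀
  oldRow-letter (shifted p<k) = trans (leadingD-prefix (D ∷ X) (m≤n⇒m≤1+n p<k)) (sym (leadingD-prefix X p<k))
  oldRow-letter (kept {suc p} _) = refl

  transition-oldRow : ∀ {p p₀ q} → OldRow k p p₀ → T′ p q ≡ T p₀ q
  transition-oldRow {p} (shifted p<k) with p <ᵇ k | <ᵇ-reflects-< p k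
  ... | true  | _        = refl
  ... | false | ofⁿ p≮k = ⊥-elim (p≮k p<k)
  transition-oldRow {p} (kept k<p) with p <ᵇ k | <ᵇ-reflects-< p k | p ≡ᵇ k | ≡ᵇ-reflects-≡ p k
  ... | true  | ofʸ p<k | _     | _       = ⊥-elim (<-asym p<k k<p)
  ... | false | _       | true  | ofʸ refl = ⊥-elim (n≮n k k<p)
  ... | false | _       | false | _        = refl

  transition-newRow : ∀ q → T′ k q ≡ (if q ≡ᵇ suc k then β else empty)
  transition-newRow q with k <ᵇ k | <ᵇ-reflects-< k k | k ≡ᵇ k | ≡ᵇ-reflects-≡ k k
  ... | true  | ofʸ k<k | _     | _        = ⊥-elim (n≮n k k<k)
  ... | false | _       | false | ofⁿ k≢k  = ⊥-elim (k≢k refl)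
  ... | false | _       | true  | _        = refl

  newRow-corner : T′ k (suc k) ≡ β
  newRow-corner with suc k ≡ᵇ suc k | ≡ᵇ-reflects-≡ (suc k) (suc k) | transition-newRow (suc k)
  ... | true  | _          | eq = eq
  ... | false | ofⁿ k+1≢k+1 | _  = ⊥-elim (k+1≢k+1 refl)

  newRow-elsewhere : ∀ {q} → q ≢ suc k → T′ k q ≡ empty
  newRow-elsewhere {q} q≢k+1 with q ≡ᵇ suc k | ≡ᵇ-reflects-≡ q (suc k) | transition-newRow q
  ... | true  | ofʸ q≡k+1 | _  = ⊥-elim (q≢k+1 q≡k+1)
  ... | false | _         | eq = eq

  newRow-not-α : ∀ q → T′ k q ≢ α
  newRow-not-α q with q ≟ suc k
  ... | yes refl rewrite newRow-corner = λ ()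
  ... | no q≢k+1 rewrite newRow-elsewhere q≢k+1 = λ ()

  betaRight-oldRow : ∀ {p p₀ q} → OldRow k p p₀ → BetaRight (D ∷ X) T′ p q ⇔ BetaRight (E ∷ X) T p₀ q
  betaRight-oldRow {p} {p₀} {q} o = mk⇔ to from
    where
    to : BetaRight (D ∷ X) T′ p q → BetaRight (E ∷ X) T p₀ q
    to (zero  , inj₁ () , _)
    to (zero  , inj₂ () , _)
    to (suc j , c , p<q′ , q′<q , eq) =
      suc j , c , oldRow-< o (leadingD≤column (D ∷ X) c) p<q′ , q′<q , trans (sym (transition-oldRow o)) eq
    from : BetaRight (E ∷ X) T p₀ q → BetaRight (D ∷ X) T′ p q
    from (zero  , _ , () , _)
    from (suc j , c , p₀<q′ , q′<q , eq) =
      suc j , c , ≤-<-trans (oldRow-≤ o) p₀<q′ , q′<q , trans (transition-oldRow o) eq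

  alphaBelow-oldRow : ∀ {p p₀ q} → OldRow k p p₀ → k < q →
    AlphaBelow (D ∷ X) T′ p q ⇔ AlphaBelow (E ∷ X) T p₀ q
  alphaBelow-oldRow {p} {p₀} {q} o k<q = mk⇔ to from
    where
    to : AlphaBelow (D ∷ X) T′ p q → AlphaBelow (E ∷ X) T p₀ q
    to (p′ , r , p<p′ , p′<q , eq) with oldRow-or-new k p′
    ... | inj₁ refl        = ⊥-elim (newRow-not-α q eq)
    ... | inj₂ (p₀′ , o′) =
      p₀′ , subst IsRowLetter (oldRow-letter o′) r , oldRow-mono o o′ p<p′ ,
      oldRow-< o′ k<q p′<q , trans (sym (transition-oldRow o′)) eq
    from : AlphaBelow (E ∷ X) T p₀ q → AlphaBelow (D ∷ X) T′ p q
    from (zero  , inj₁ () , _)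
    from (zero  , inj₂ () , _)
    from (suc j , r , p₀<p₀′ , p₀′<q , eq) with oldRow-onto k j
    ... | p′ , o′ =
      p′ , subst IsRowLetter (sym (oldRow-letter o′)) r , oldRow-reflects o o′ p₀<p₀′ ,
      ≤-<-trans (oldRow-≤ o′) p₀′<q , trans (transition-oldRow o′) eq

  validAt-oldRow : Valid (E ∷ X) T → ∀ {p p₀ q} → OldRow k p p₀ → Box (D ∷ X) p q →
    ValidAt (D ∷ X) T′ p q
  validAt-oldRow _ {q = zero} _ (_ , inj₁ () , _)
  validAt-oldRow _ {q = zero} _ (_ , inj₂ () , _)
  validAt-oldRow valid {p₀ = p₀} {q = suc j} o (r , c , p<q) =
    validAt-transport {E ∷ X} {D ∷ X} {T} {T′}
      (betaRight-oldRow o ⊎-⇔ alphaBelow-oldRow o k<q)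
      (transition-oldRow o) (oldRow-letter o) refl
      (valid p₀ (suc j) (subst IsRowLetter (oldRow-letter o) r , c , oldRow-< o k<q p<q))
    where k<q = leadingD≤column (D ∷ X) {suc j} c

  validAt-newRow : ∀ {q} → IsCol (D ∷ X) q → ValidAt (D ∷ X) T′ k q
  validAt-newRow {q} c with m≤n⇒m<n∨m≡n (leadingD≤column (D ∷ X) {q} c)
  ... | inj₂ refl = (λ f → ⊥-elim (corner-unforced f)) , λ _ → corner-allowed
    where
    corner-unforced : ¬ Forced (D ∷ X) T′ k (suc k)
    corner-unforced (inj₁ (_ , _ , k<q′ , q′<k+1 , _)) = n≮n k (<-≤-trans k<q′ (≤-pred q′<k+1))
    corner-unforced (inj₂ (_ , _ , k<p′ , p′<k+1 , _)) = n≮n k (<-≤-trans k<p′ (≤-pred p′<k+1))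
    corner-allowed : Allowed (at (D ∷ X) k) (at X k) (T′ k (suc k))
    corner-allowed rewrite newRow-corner | leadingD-prefix (D ∷ X) (n<1+n k) = β-allowed-in-D-row c
  ... | inj₁ k+1<q =
    (λ _ → newRow-elsewhere (λ q≡k+1 → <⇒≢ k+1<q (sym q≡k+1))) ,
    (λ unforced → ⊥-elim (unforced
      (inj₁ (suc k , column-at-leadingD (D ∷ X) {q} c , n<1+n k , k+1<q , newRow-corner))))

lemma4p5 : (X : List Letter) (T : Filling) →
    Valid (E ∷ X) T → Valid (D ∷ X) (transition X T)
lemma4p5 X T valid p q box with oldRow-or-new (leadingD X) p
... | inj₁ refl      = validAt-newRow X T (proj₁ (proj₂ box))
... | inj₂ (_ , old) = validAt-oldRow X T valid old box
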